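{- There is a function $f:\mathbb{Q}\to\{0,1,2,3\}$ such that for every $x\in\mathbb{Q}$ the set $S_x=\{h\in\mathbb{Q}: h>0,\ f(x-h)=f(x+h)\}$ is finite. -}

module Defs where

open import Data.Rational using (ℚ)
open import Data.List using (List)
open import Data.List.Membership.Propositional using (_∈_)
open import Data.Product using (∃)

FiniteSet : (ℚ → Set) → Set
FiniteSet P = ∃ λ (L : List ℚ) → ∀ h → P h → h ∈ L

-- Colour y by the sign of y and the parity of ⌊(N − 1)! y⌋, where N is the least n with n! y ∈ ℤ.
-- Fix x with denominator B, so that n! x ∈ ℤ for all n ≥ B, and let x − h and x + h have the same
-- colour. If B! (x − h) ∉ ℤ, then for n ≥ B the numbers n! (x − h) and n! (x + h) are integers
-- simultaneously, their sum 2 n! x being one; so both points have the same N > B, and at level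
-- N − 1 they are non-integers with an even integer sum. Their floors then add up to an odd number
-- and have different parities, a contradiction. Hence B! h ∈ ℤ, and since x − h and x + h have the
-- same sign, h ≤ |x|: only finitely many h remain.

module Submission where

open import Data.Fin using (Fin; zero; suc; fromℕ<; combine; remQuot)
open import Data.Fin.Properties using (fromℕ<-injective; remQuot-combine)
open import Data.Integer as ℤ using (ℤ; +_; -[1+_]; +<+; 1ℤ; 0ℤ)
import Data.Integer.Properties as ℤ
open import Data.Integer.DivMod using (_%_; _%ℕ_; _/ℕ_; a≡a%n+[a/n]*n; n%d<d; n%ℕd<d; a≡a%ℕn+[a/ℕn]*n)
open import Data.Integer.Tactic.RingSolver using (solve-∀)
open import Data.List using (map; upTo)
open import Data.List.Membership.Propositional using (_∈_)
open import Data.List.Membership.Propositional.Properties using (∈-map⁺; ∈-upTo⁺)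
open import Data.Nat as ℕ using (ℕ; zero; suc; _!; _≤′_; ≤′-refl; ≤′-step)
import Data.Nat.Properties as ℕ
open import Data.Nat.Coprimality using (Coprime; coprime?; 1-coprimeTo) renaming (sym to coprime-sym)
open import Data.Nat.Divisibility using (_∣_; divides; ∣-refl)
open import Data.Product using (∃; _×_; _,_; proj₁; proj₂)
open import Data.Product.Properties using (,-injectiveˡ; ,-injectiveʳ)
open import Data.Rational
  using (ℚ; mkℚ; 0ℚ; 1ℚ; _+_; _-_; _*_; -_; 1/_; ∣_∣; _<_; _≤_; *<*; *≤*; ↥_; ↧_; ↧ₙ_; floor; Positive; positive; toℚᵘ)
import Data.Rational.Properties as ℚ
import Data.Rational.Solver as ℚ
import Algebra.Properties.AbelianGroup as AbelianGroupProperties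
import Data.Rational.Unnormalised.Properties as ℚᵘ
open import Data.Rational.Unnormalised using (*≡*) renaming (_≃_ to _≃ᵘ_)
open import Relation.Binary.PropositionalEquality
open import Relation.Nullary using (¬_; Dec; yes; no; contradiction)
open import Relation.Nullary.Decidable using (recompute; map′)
open import Relation.Unary using (Decidable)

open import Defs

module +-AbelianGroup = AbelianGroupProperties ℚ.+-0-abelianGroup

fromℤ : ℤ → ℚ
fromℤ k = mkℚ k 0 (coprime-sym (1-coprimeTo ℤ.∣ k ∣))

fromℤ-homo-+ : ∀ i j → fromℤ (i ℤ.+ j) ≡ fromℤ i + fromℤ j
fromℤ-homo-+ i j = sym (ℚ.toℚᵘ-injective
  (ℚᵘ.≃-trans (ℚ.toℚᵘ-homo-+ (fromℤ i) (fromℤ j)) (*≡* (lemma i j))))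
  where
  lemma : ∀ i j → (i ℤ.* + 1 ℤ.+ j ℤ.* + 1) ℤ.* + 1 ≡ (i ℤ.+ j) ℤ.* + 1
  lemma = solve-∀

fromℤ-homo-* : ∀ i j → fromℤ (i ℤ.* j) ≡ fromℤ i * fromℤ j
fromℤ-homo-* i j = sym (ℚ.toℚᵘ-injective
  (ℚᵘ.≃-trans (ℚ.toℚᵘ-homo-* (fromℤ i) (fromℤ j)) (*≡* refl)))

fromℤ-homo-neg : ∀ i → fromℤ (ℤ.- i) ≡ - fromℤ i
fromℤ-homo-neg -[1+ n ]  = refl
fromℤ-homo-neg (+ zero)  = refl
fromℤ-homo-neg (+ suc n) = refl

fromℤ-mono-< : ∀ {i j} → i ℤ.< j → fromℤ i < fromℤ j
fromℤ-mono-< {i} {j} i<j = *<* (subst₂ ℤ._<_ (sym (ℤ.*-identityʳ i)) (sym (ℤ.*-identityʳ j)) i<j)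

fromℤ-cancel-< : ∀ {i j} → fromℤ i < fromℤ j → i ℤ.< j
fromℤ-cancel-< {i} {j} (*<* i<j) = subst₂ ℤ._<_ (ℤ.*-identityʳ i) (ℤ.*-identityʳ j) i<j

fromℤ-cancel-≤ : ∀ {i j} → fromℤ i ≤ fromℤ j → i ℤ.≤ j
fromℤ-cancel-≤ {i} {j} (*≤* i≤j) = subst₂ ℤ._≤_ (ℤ.*-identityʳ i) (ℤ.*-identityʳ j) i≤j

IsInteger : ℚ → Set
IsInteger q = ∃ λ k → q ≡ fromℤ k

isInteger? : Decidable IsInteger
isInteger? (mkℚ n zero _)    = yes (n , refl)
isInteger? (mkℚ n (suc d) _) = no λ { (k , eq) → ℕ.1+n≢0 (cong (λ q → ℕ.pred (↧ₙ q)) eq) }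

IsInteger-+ : ∀ {p q} → IsInteger p → IsInteger q → IsInteger (p + q)
IsInteger-+ (i , refl) (j , refl) = i ℤ.+ j , sym (fromℤ-homo-+ i j)

IsInteger-* : ∀ {p q} → IsInteger p → IsInteger q → IsInteger (p * q)
IsInteger-* (i , refl) (j , refl) = i ℤ.* j , sym (fromℤ-homo-* i j)

IsInteger-neg : ∀ {p} → IsInteger p → IsInteger (- p)
IsInteger-neg (i , refl) = ℤ.- i , sym (fromℤ-homo-neg i)

floor-euclidean : ∀ p → ↥ p ≡ + (↥ p % ↧ p) ℤ.+ ⌊ p ⌋ ℤ.* ↧ p
floor-euclidean p@record{} = a≡a%n+[a/n]*n (↥ p) (↧ p)

%≡0⇒IsInteger : ∀ p → ↥ p % ↧ p ≡ 0 → IsInteger p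
%≡0⇒IsInteger p@(mkℚ n d coprime) r≡0 =
  integral coprime (ℕ.suc-injective (recompute (coprime? _ _) coprime (↧∣↥ , ∣-refl)))
  where
  integral : ∀ {d} .(c : Coprime ℤ.∣ n ∣ (suc d)) → d ≡ 0 → IsInteger (mkℚ n d c)
  integral _ refl = n , refl
  ↧∣↥ : suc d ∣ ℤ.∣ n ∣
  ↧∣↥ = divides ℤ.∣ ⌊ p ⌋ ∣ (begin
    ℤ.∣ n ∣                            ≡⟨ cong ℤ.∣_∣ (floor-euclidean p) ⟩
    ℤ.∣ + (n % ↧ p) ℤ.+ ⌊ p ⌋ ℤ.* ↧ p ∣ ≡⟨ cong (λ r → ℤ.∣ + r ℤ.+ ⌊ p ⌋ ℤ.* ↧ p ∣) r≡0 ⟩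
    ℤ.∣ 0ℤ ℤ.+ ⌊ p ⌋ ℤ.* ↧ p ∣          ≡⟨ cong ℤ.∣_∣ (ℤ.+-identityˡ (⌊ p ⌋ ℤ.* ↧ p)) ⟩
    ℤ.∣ ⌊ p ⌋ ℤ.* ↧ p ∣                ≡⟨ ℤ.abs-* ⌊ p ⌋ (↧ p) ⟩
    ℤ.∣ ⌊ p ⌋ ∣ ℕ.* suc d              ∎)
    where open ≡-Reasoning

k↧≤↥⇒fromℤ≤ : ∀ {k} p → k ℤ.* ↧ p ℤ.≤ ↥ p → fromℤ k ≤ p
k↧≤↥⇒fromℤ≤ {k} p k↧p≤↥p = *≤* (subst (k ℤ.* ↧ p ℤ.≤_) (sym (ℤ.*-identityʳ (↥ p))) k↧p≤↥p)

k↧<↥⇒fromℤ< : ∀ {k} p → k ℤ.* ↧ p ℤ.< ↥ p → fromℤ k < p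
k↧<↥⇒fromℤ< {k} p k↧p<↥p = *<* (subst (k ℤ.* ↧ p ℤ.<_) (sym (ℤ.*-identityʳ (↥ p))) k↧p<↥p)

↥<k↧⇒<fromℤ : ∀ {k} p → ↥ p ℤ.< k ℤ.* ↧ p → p < fromℤ k
↥<k↧⇒<fromℤ {k} p ↥p<k↧p = *<* (subst (ℤ._< k ℤ.* ↧ p) (sym (ℤ.*-identityʳ (↥ p))) ↥p<k↧p)

floor-≤ : ∀ p → fromℤ ⌊ p ⌋ ≤ p
floor-≤ p = k↧≤↥⇒fromℤ≤ p
  (subst (⌊ p ⌋ ℤ.* ↧ p ℤ.≤_) (sym (floor-euclidean p)) (ℤ.i≤j+i _ (+ (↥ p % ↧ p))))

floor-< : ∀ p → ¬ IsInteger p → fromℤ ⌊ p ⌋ < p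
floor-< p ¬integer with ↥ p % ↧ p in r≡ | floor-euclidean p
... | zero  | _   = contradiction (%≡0⇒IsInteger p r≡) ¬integer
... | suc r | ↥p≡ = k↧<↥⇒fromℤ< p (begin-strict
  ⌊ p ⌋ ℤ.* ↧ p                   ≡⟨ ℤ.+-identityˡ _ ⟨
  0ℤ ℤ.+ ⌊ p ⌋ ℤ.* ↧ p             <⟨ ℤ.+-monoˡ-< (⌊ p ⌋ ℤ.* ↧ p) (+<+ ℕ.z<s) ⟩
  + suc r ℤ.+ ⌊ p ⌋ ℤ.* ↧ p        ≡⟨ ↥p≡ ⟨
  ↥ p                             ∎)
  where open ℤ.≤-Reasoning

<-suc-floor : ∀ p → p < fromℤ (ℤ.suc ⌊ p ⌋)
<-suc-floor p@record{} = ↥<k↧⇒<fromℤ p (begin-strict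
  ↥ p                               ≡⟨ floor-euclidean p ⟩
  + (↥ p % ↧ p) ℤ.+ ⌊ p ⌋ ℤ.* ↧ p    <⟨ ℤ.+-monoˡ-< (⌊ p ⌋ ℤ.* ↧ p) (+<+ (n%d<d (↥ p) (↧ p))) ⟩
  ↧ p ℤ.+ ⌊ p ⌋ ℤ.* ↧ p              ≡⟨ ℤ.suc-* ⌊ p ⌋ (↧ p) ⟨
  ℤ.suc ⌊ p ⌋ ℤ.* ↧ p                ∎)
  where open ℤ.≤-Reasoning

i<j<2+i⇒j≡1+i : ∀ {i j} → i ℤ.< j → j ℤ.< ℤ.suc (ℤ.suc i) → j ≡ ℤ.suc i
i<j<2+i⇒j≡1+i {i} {j} i<j j<2+i = ℤ.≤-antisym
  (subst (j ℤ.≤_) (ℤ.pred-suc (ℤ.suc i)) (ℤ.i<j⇒i≤pred[j] j<2+i))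
  (ℤ.i<j⇒suc[i]≤j i<j)

floor-+-nonInteger : ∀ a b {m} → a + b ≡ fromℤ m → ¬ IsInteger a → m ≡ ℤ.suc (⌊ a ⌋ ℤ.+ ⌊ b ⌋)
floor-+-nonInteger a b {m} a+b≡m ¬integer = i<j<2+i⇒j≡1+i (fromℤ-cancel-< lower) (fromℤ-cancel-< upper)
  where
  open ℚ.≤-Reasoning
  lower : fromℤ (⌊ a ⌋ ℤ.+ ⌊ b ⌋) < fromℤ m
  lower = begin-strict
    fromℤ (⌊ a ⌋ ℤ.+ ⌊ b ⌋)     ≡⟨ fromℤ-homo-+ ⌊ a ⌋ ⌊ b ⌋ ⟩
    fromℤ ⌊ a ⌋ + fromℤ ⌊ b ⌋   <⟨ ℚ.+-mono-<-≤ (floor-< a ¬integer) (floor-≤ b) ⟩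
    a + b                       ≡⟨ a+b≡m ⟩
    fromℤ m                     ∎
  upper : fromℤ m < fromℤ (ℤ.suc (ℤ.suc (⌊ a ⌋ ℤ.+ ⌊ b ⌋)))
  upper = begin-strict
    fromℤ m                                   ≡⟨ a+b≡m ⟨
    a + b                                     <⟨ ℚ.+-mono-< (<-suc-floor a) (<-suc-floor b) ⟩
    fromℤ (ℤ.suc ⌊ a ⌋) + fromℤ (ℤ.suc ⌊ b ⌋) ≡⟨ fromℤ-homo-+ (ℤ.suc ⌊ a ⌋) (ℤ.suc ⌊ b ⌋) ⟨
    fromℤ (ℤ.suc ⌊ a ⌋ ℤ.+ ℤ.suc ⌊ b ⌋)       ≡⟨ cong fromℤ (sucs ⌊ a ⌋ ⌊ b ⌋) ⟩
    fromℤ (ℤ.suc (ℤ.suc (⌊ a ⌋ ℤ.+ ⌊ b ⌋)))   ∎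
    where
    sucs : ∀ i j → (1ℤ ℤ.+ i) ℤ.+ (1ℤ ℤ.+ j) ≡ 1ℤ ℤ.+ (1ℤ ℤ.+ (i ℤ.+ j))
    sucs = solve-∀

parity : ℤ → Fin 2
parity i = fromℕ< (n%ℕd<d i 2)

1≢2*i : ∀ i → 1ℤ ≢ + 2 ℤ.* i
1≢2*i (+ zero)        ()
1≢2*i (+ suc zero)    ()
1≢2*i (+ suc (suc _)) ()
1≢2*i -[1+ _ ]        ()

odd⇒parity≢ : ∀ i j k → ℤ.suc (i ℤ.+ j) ≡ k ℤ.+ k → parity i ≢ parity j
odd⇒parity≢ i j k odd same = 1≢2*i z (begin
  1ℤ                                                            ≡⟨ cancel i j ⟨
  ℤ.suc (i ℤ.+ j) ℤ.- (i ℤ.+ j)                                  ≡⟨ cong₂ ℤ._-_ odd (cong₂ ℤ._+_ i≡ j≡) ⟩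
  (k ℤ.+ k) ℤ.- ((+ r ℤ.+ qi ℤ.* + 2) ℤ.+ (+ r ℤ.+ qj ℤ.* + 2))  ≡⟨ halve (+ r) qi qj k ⟩
  + 2 ℤ.* z                                                     ∎)
  where
  open ≡-Reasoning
  r = j %ℕ 2
  qi = i /ℕ 2
  qj = j /ℕ 2
  z = k ℤ.- (+ r ℤ.+ qi ℤ.+ qj)
  i≡ : i ≡ + r ℤ.+ qi ℤ.* + 2
  i≡ = trans (a≡a%ℕn+[a/ℕn]*n i 2) (cong (λ s → + s ℤ.+ qi ℤ.* + 2) (fromℕ<-injective _ _ _ _ same))
  j≡ : j ≡ + r ℤ.+ qj ℤ.* + 2
  j≡ = a≡a%ℕn+[a/ℕn]*n j 2
  cancel : ∀ i j → (1ℤ ℤ.+ (i ℤ.+ j)) ℤ.- (i ℤ.+ j) ≡ 1ℤ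
  cancel = solve-∀
  halve : ∀ r qi qj k →
          (k ℤ.+ k) ℤ.- ((r ℤ.+ qi ℤ.* + 2) ℤ.+ (r ℤ.+ qj ℤ.* + 2)) ≡ + 2 ℤ.* (k ℤ.- (r ℤ.+ qi ℤ.+ qj))
  halve = solve-∀

factorial : ℕ → ℚ
factorial n = fromℤ (+ (n !))

0<factorial : ∀ n → 0ℚ < factorial n
0<factorial n = fromℤ-mono-< (+<+ (ℕ.1≤n! n))

factorial-suc : ∀ n → factorial (suc n) ≡ fromℤ (+ suc n) * factorial n
factorial-suc n = trans (cong fromℤ (ℤ.pos-* (suc n) (n !))) (fromℤ-homo-* (+ suc n) (+ (n !)))

record Clears (n : ℕ) (y : ℚ) : Set where
  constructor clears
  field integral : IsInteger (factorial n * y)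

clears? : ∀ n y → Dec (Clears n y)
clears? n y = map′ clears Clears.integral (isInteger? (factorial n * y))

clears-suc : ∀ {n y} → Clears n y → Clears (suc n) y
clears-suc {n} {y} (clears integral) =
  clears (subst IsInteger (sym eq) (IsInteger-* (+ suc n , refl) integral))
  where
  eq : factorial (suc n) * y ≡ fromℤ (+ suc n) * (factorial n * y)
  eq = trans (cong (_* y) (factorial-suc n)) (ℚ.*-assoc (fromℤ (+ suc n)) (factorial n) y)

clears-mono′ : ∀ {m n y} → m ≤′ n → Clears m y → Clears n y
clears-mono′ ≤′-refl        cleared = cleared
clears-mono′ (≤′-step m≤′n) cleared = clears-suc (clears-mono′ m≤′n cleared)

clears-mono : ∀ {m n y} → m ℕ.≤ n → Clears m y → Clears n y
clears-mono m≤n = clears-mono′ (ℕ.≤⇒≤′ m≤n)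

clears-denominator : ∀ y → Clears (↧ₙ y) y
clears-denominator y@(mkℚ n d _) = clears (n ℤ.* + (d !) , ℚ.toℚᵘ-injective scaled)
  where
  open ≡-Reasoning
  rearrange : ∀ a b c → ((a ℤ.* b) ℤ.* c) ℤ.* 1ℤ ≡ (c ℤ.* b) ℤ.* a
  rearrange = solve-∀
  scaled : toℚᵘ (factorial (suc d) * y) ≃ᵘ toℚᵘ (fromℤ (n ℤ.* + (d !)))
  scaled = ℚᵘ.≃-trans (ℚ.toℚᵘ-homo-* (factorial (suc d)) y) (*≡* (begin
    (+ (suc d !) ℤ.* n) ℤ.* 1ℤ             ≡⟨ cong (λ f → (f ℤ.* n) ℤ.* 1ℤ) (ℤ.pos-* (suc d) (d !)) ⟩
    ((+ suc d ℤ.* + (d !)) ℤ.* n) ℤ.* 1ℤ   ≡⟨ rearrange (+ suc d) (+ (d !)) n ⟩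
    (n ℤ.* + (d !)) ℤ.* + suc d            ≡⟨ cong (λ e → (n ℤ.* + (d !)) ℤ.* + suc e) (ℕ.+-identityʳ d) ⟨
    (n ℤ.* + (d !)) ℤ.* + suc (d ℕ.+ 0)    ∎))

clears-+ : ∀ {n y z} → Clears n y → Clears n z → Clears n (y + z)
clears-+ {n} {y} {z} (clears iy) (clears iz) =
  clears (subst IsInteger (sym (ℚ.*-distribˡ-+ (factorial n) y z)) (IsInteger-+ iy iz))

clears-neg : ∀ {n y} → Clears n y → Clears n (- y)
clears-neg {n} {y} (clears iy) =
  clears (subst IsInteger (ℚ.neg-distribʳ-* (factorial n) y) (IsInteger-neg iy))

clears-mirror : ∀ {n x y z} → y + z ≡ x + x → Clears n x → Clears n y → Clears n z
clears-mirror {n} {x} {y} {z} y+z≡x+x cx cy =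
  subst (Clears n) z≡ (clears-+ (clears-+ cx cx) (clears-neg cy))
  where
  z≡ : (x + x) - y ≡ z
  z≡ = trans (cong (_- y) (sym y+z≡x+x)) (+-AbelianGroup.xyx⁻¹≈y y z)

least-witness : ∀ {P : ℕ → Set} → Decidable P → ∀ {n} → P n →
                ∃ λ m → P m × (∀ {k} → k ℕ.< m → ¬ P k)
least-witness P? {zero} p0 = 0 , p0 , λ ()
least-witness P? {suc n} p with P? 0
... | yes p0 = 0 , p0 , λ ()
... | no ¬p0 with least-witness (λ k → P? (suc k)) p
...   | m , pm , below = suc m , pm , λ { {zero} _ → ¬p0 ; {suc k} k<m → below (ℕ.s<s⁻¹ k<m) }

least-clearing : ∀ y → ∃ λ m → Clears m y × (∀ {k} → k ℕ.< m → ¬ Clears k y)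
least-clearing y = least-witness (λ n → clears? n y) (clears-denominator y)

order : ℚ → ℕ
order y = proj₁ (least-clearing y)

order-clears : ∀ y → Clears (order y) y
order-clears y = proj₁ (proj₂ (least-clearing y))

<-order⇒¬clears : ∀ {k y} → k ℕ.< order y → ¬ Clears k y
<-order⇒¬clears {y = y} = proj₂ (proj₂ (least-clearing y))

order-minimal : ∀ {n y} → Clears n y → order y ℕ.≤ n
order-minimal cleared = ℕ.≮⇒≥ (λ n<order → <-order⇒¬clears n<order cleared)

¬clears⇒<-order : ∀ {n y} → ¬ Clears n y → n ℕ.< order y
¬clears⇒<-order {y = y} ¬cleared = ℕ.≰⇒> (λ order≤n → ¬cleared (clears-mono order≤n (order-clears y)))

order-mirror : ∀ {n x y z} → y + z ≡ x + x → Clears n x → ¬ Clears n y → order y ≡ order z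
order-mirror {n} {x} {y} {z} y+z≡x+x cx ¬cy = ℕ.≤-antisym
  (order-minimal (mirror {z} {y} z+y≡x+x (order-clears z) n<order-z))
  (order-minimal (mirror {y} {z} y+z≡x+x (order-clears y) n<order-y))
  where
  z+y≡x+x : z + y ≡ x + x
  z+y≡x+x = trans (ℚ.+-comm z y) y+z≡x+x
  mirror : ∀ {u v m} → u + v ≡ x + x → Clears m u → n ℕ.< m → Clears m v
  mirror u+v≡x+x cu n<m = clears-mirror u+v≡x+x (clears-mono (ℕ.<⇒≤ n<m) cx) cu
  n<order-y : n ℕ.< order y
  n<order-y = ¬clears⇒<-order ¬cy
  n<order-z : n ℕ.< order z
  n<order-z = ¬clears⇒<-order {y = z} (λ cz → ¬cy (clears-mirror z+y≡x+x cx cz))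

scaledFloor : ℚ → ℤ
scaledFloor y = ⌊ factorial (ℕ.pred (order y)) * y ⌋

mirror-parity≢ : ∀ {n x y z} → y + z ≡ x + x → Clears n x → ¬ Clears n y →
                 parity (scaledFloor y) ≢ parity (scaledFloor z)
mirror-parity≢ {n} {x} {y} {z} y+z≡x+x cx ¬cy
  rewrite sym (order-mirror y+z≡x+x cx ¬cy) = odd⇒parity≢ ⌊ f * y ⌋ ⌊ f * z ⌋ k (sym odd)
  where
  m = ℕ.pred (order y)
  f = factorial m
  n<order : n ℕ.< order y
  n<order = ¬clears⇒<-order ¬cy
  m<order : m ℕ.< order y
  m<order = pred< n<order
    where
    pred< : ∀ {a b} → a ℕ.< b → ℕ.pred b ℕ.< b
    pred< (ℕ.s≤s _) = ℕ.n<1+n _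
  k = proj₁ (Clears.integral (clears-mono (ℕ.<⇒≤pred n<order) cx))
  fx≡k : f * x ≡ fromℤ k
  fx≡k = proj₂ (Clears.integral (clears-mono (ℕ.<⇒≤pred n<order) cx))
  sum : f * y + f * z ≡ fromℤ (k ℤ.+ k)
  sum = begin
    f * y + f * z         ≡⟨ ℚ.*-distribˡ-+ f y z ⟨
    f * (y + z)           ≡⟨ cong (f *_) y+z≡x+x ⟩
    f * (x + x)           ≡⟨ ℚ.*-distribˡ-+ f x x ⟩
    f * x + f * x         ≡⟨ cong₂ _+_ fx≡k fx≡k ⟩
    fromℤ k + fromℤ k     ≡⟨ fromℤ-homo-+ k k ⟨
    fromℤ (k ℤ.+ k)       ∎
    where open ≡-Reasoning
  odd : k ℤ.+ k ≡ ℤ.suc (⌊ f * y ⌋ ℤ.+ ⌊ f * z ⌋)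
  odd = floor-+-nonInteger (f * y) (f * z) sum (λ integral → <-order⇒¬clears m<order (clears {y = y} integral))

negativity : ℚ → Fin 2
negativity y with y ℚ.<? 0ℚ
... | yes _ = zero
... | no  _ = suc zero

negativity-<0 : ∀ {y z} → negativity y ≡ negativity z → y < 0ℚ → z < 0ℚ
negativity-<0 {y} {z} same y<0 with y ℚ.<? 0ℚ | z ℚ.<? 0ℚ
... | yes _   | yes z<0 = z<0
... | no y≮0  | _       = contradiction y<0 y≮0
... | yes _   | no _    with () ← same

colour : ℚ → Fin 4
colour y = combine (negativity y) (parity (scaledFloor y))

combine-injective : ∀ {m n} {i k : Fin m} {j l : Fin n} → combine i j ≡ combine k l → i ≡ k × j ≡ l
combine-injective {n = n} {i} {k} {j} {l} eq = ,-injectiveˡ ij≡kl , ,-injectiveʳ ij≡kl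
  where
  ij≡kl = trans (sym (remQuot-combine i j)) (trans (cong (remQuot n) eq) (remQuot-combine k l))

colour-components : ∀ y z → colour y ≡ colour z →
                    negativity y ≡ negativity z × parity (scaledFloor y) ≡ parity (scaledFloor z)
colour-components y z =
  combine-injective {i = negativity y} {negativity z} {parity (scaledFloor y)} {parity (scaledFloor z)}

p≤∣p∣ : ∀ p → p ≤ ∣ p ∣
p≤∣p∣ (mkℚ (+ _)      _ _) = ℚ.≤-refl
p≤∣p∣ (mkℚ -[1+ _ ]   _ _) = ℚ.<⇒≤ (ℚ.neg<pos _ _)

same-side⇒≤∣centre∣ : ∀ x h → (x - h < 0ℚ → x + h < 0ℚ) → h ≤ ∣ x ∣
same-side⇒≤∣centre∣ x h same-side with x - h ℚ.<? 0ℚ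
... | no x-h≮0 = ℚ.≤-trans h≤x (p≤∣p∣ x)
  where
  h≤x : h ≤ x
  h≤x = begin
    h             ≡⟨ ℚ.+-identityʳ h ⟨
    h + 0ℚ        ≤⟨ ℚ.+-monoʳ-≤ h (ℚ.≮⇒≥ x-h≮0) ⟩
    h + (x - h)   ≡⟨ ℚ.+-assoc h x (- h) ⟨
    (h + x) - h   ≡⟨ +-AbelianGroup.xyx⁻¹≈y h x ⟩
    x             ∎
    where open ℚ.≤-Reasoning
... | yes x-h<0 = ℚ.≤-trans h≤-x (subst (- x ≤_) (ℚ.∣-p∣≡∣p∣ x) (p≤∣p∣ (- x)))
  where
  h≤-x : h ≤ - x
  h≤-x = ℚ.<⇒≤ (begin-strict
    h             ≡⟨ +-AbelianGroup.xyx⁻¹≈y x h ⟨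
    (x + h) - x   <⟨ ℚ.+-monoˡ-< (- x) (same-side x-h<0) ⟩
    0ℚ - x        ≡⟨ ℚ.+-identityˡ (- x) ⟩
    - x           ∎)
    where open ℚ.≤-Reasoning

finite-bounded-multiples : ∀ d .{{_ : Positive d}} c → IsInteger (d * c) →
                           FiniteSet (λ h → 0ℚ ≤ h × h ≤ c × IsInteger (d * h))
finite-bounded-multiples d c (m , dc≡m) = map multiple (upTo (suc ℤ.∣ m ∣)) , member
  where
  instance
    _ = ℚ.pos⇒nonZero d
    _ = ℚ.pos⇒nonNeg d
  multiple : ℕ → ℚ
  multiple j = fromℤ (+ j) * 1/ d
  member : ∀ h → 0ℚ ≤ h × h ≤ c × IsInteger (d * h) → h ∈ map multiple (upTo (suc ℤ.∣ m ∣))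
  member h (0≤h , h≤c , (i , dh≡i)) = subst (_∈ _) h≡ (∈-map⁺ multiple (∈-upTo⁺ (ℕ.s≤s ∣i∣≤∣m∣)))
    where
    0≤i : 0ℤ ℤ.≤ i
    0≤i = fromℤ-cancel-≤ (subst₂ _≤_ (ℚ.*-zeroʳ d) dh≡i (ℚ.*-monoˡ-≤-nonNeg d 0≤h))
    i≤m : i ℤ.≤ m
    i≤m = fromℤ-cancel-≤ (subst₂ _≤_ dh≡i dc≡m (ℚ.*-monoˡ-≤-nonNeg d h≤c))
    ∣i∣≤∣m∣ : ℤ.∣ i ∣ ℕ.≤ ℤ.∣ m ∣
    ∣i∣≤∣m∣ = ℤ.drop‿+≤+
      (subst₂ ℤ._≤_ (sym (ℤ.0≤i⇒+∣i∣≡i 0≤i)) (sym (ℤ.0≤i⇒+∣i∣≡i (ℤ.≤-trans 0≤i i≤m))) i≤m)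
    h≡ : multiple ℤ.∣ i ∣ ≡ h
    h≡ = begin
      fromℤ (+ ℤ.∣ i ∣) * 1/ d  ≡⟨ cong (λ k → fromℤ k * 1/ d) (ℤ.0≤i⇒+∣i∣≡i 0≤i) ⟩
      fromℤ i * 1/ d           ≡⟨ cong (_* 1/ d) (sym dh≡i) ⟩
      (d * h) * 1/ d           ≡⟨ cong (_* 1/ d) (ℚ.*-comm d h) ⟩
      (h * d) * 1/ d           ≡⟨ ℚ.*-assoc h d (1/ d) ⟩
      h * (d * 1/ d)           ≡⟨ cong (h *_) (ℚ.*-inverseʳ d) ⟩
      h * 1ℚ                   ≡⟨ ℚ.*-identityʳ h ⟩
      h                        ∎
      where open ≡-Reasoning

clears-∣∣ : ∀ {n y} → Clears n y → Clears n ∣ y ∣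
clears-∣∣ {n} {y} (clears (k , fy≡k)) =
  clears (+ ℤ.∣ k ∣ , trans (sym (ℚ.∣p*q∣≡∣p∣*∣q∣ (factorial n) y)) (cong ∣_∣ fy≡k))

mirror-sum : ∀ x h → (x - h) + (x + h) ≡ x + x
mirror-sum = solve 2 (λ x h → (x :- h) :+ (x :+ h) := x :+ x) refl
  where open ℚ.+-*-Solver

clears-offset : ∀ {n x h} → Clears n x → Clears n (x - h) → Clears n h
clears-offset {n} {x} {h} cx cx-h =
  subst (Clears n) (+-AbelianGroup.xyx⁻¹≈y x h) (clears-+ cx+h (clears-neg cx))
  where
  cx+h : Clears n (x + h)
  cx+h = clears-mirror (mirror-sum x h) cx cx-h

same-colour⇒clears : ∀ x h → colour (x - h) ≡ colour (x + h) → Clears (↧ₙ x) (x - h)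
same-colour⇒clears x h same with clears? (↧ₙ x) (x - h)
... | yes cleared = cleared
... | no ¬cleared = contradiction (proj₂ (colour-components (x - h) (x + h) same))
                                 (mirror-parity≢ (mirror-sum x h) (clears-denominator x) ¬cleared)

same-colour⇒bounded-multiple : ∀ x h → 0ℚ < h → colour (x - h) ≡ colour (x + h) →
                               0ℚ ≤ h × h ≤ ∣ x ∣ × IsInteger (factorial (↧ₙ x) * h)
same-colour⇒bounded-multiple x h 0<h same =
    ℚ.<⇒≤ 0<h
  , same-side⇒≤∣centre∣ x h (negativity-<0 (proj₁ (colour-components (x - h) (x + h) same)))
  , Clears.integral (clears-offset (clears-denominator x) (same-colour⇒clears x h same))

theorem6 : ∃ λ (f : ℚ → Fin 4) → ∀ (x : ℚ) → FiniteSet (λ h → (0ℚ < h) × (f (x - h) ≡ f (x + h)))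
theorem6 = colour , λ x →
  let B = ↧ₙ x
      (L , bounded⊆L) = finite-bounded-multiples (factorial B) {{positive (0<factorial B)}} ∣ x ∣
                          (Clears.integral (clears-∣∣ (clears-denominator x)))
  in  L , λ h (0<h , same) → bounded⊆L h (same-colour⇒bounded-multiple x h 0<h same)
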